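{- Let $G$ be a graph with a weak support vertex $u$ adjacent to the leaf $v$, and let $G'=G-\{u,v\}$. Then $\gamma'_{\rm SMB}(G)-1\le\gamma'_{\rm SMB}(G')\le\gamma'_{\rm SMB}(G)$ and $\gamma_{\rm SMB}(G')\le\gamma_{\rm SMB}(G)$.
   Context: A leaf is a vertex of degree $1$; a support vertex is a neighbor of a leaf; it is weak if it is adjacent to exactly one leaf. All graphs are finite and simple; $N_G[v]$ is the closed neighborhood of $v$. The Maker-Breaker domination game on $G$ is played by Dominator and Staller, who alternately play a vertex not played before. Dominator wins if the set of vertices he has played is a dominating set of $G$; Staller wins if she has played all vertices of $N_G[v]$ for some $v\in V(G)$. In the D-game Dominator moves first, in the S-game Staller moves first. $\gamma_{\rm SMB}(G)$ (resp. $\gamma'_{\rm SMB}(G)$) is the smallest integer $k$ such that in the D-game (resp. S-game), under any strategy of Dominator, Staller can win having played at most $k$ vertices; the value is $\infty$ if Staller has no winning strategy (with $\infty-1=\infty$). -}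

module Defs where

open import Data.Nat using (ℕ; zero; suc)
open import Data.Fin using (Fin; _≟_)
open import Data.Bool using (Bool; true; false; if_then_else_; not; _∨_)
open import Data.Product using (Σ; ∃; _×_; _,_)
open import Data.Sum using (_⊎_)
open import Relation.Nullary using (¬_)
open import Relation.Nullary.Decidable using (⌊_⌋)
open import Relation.Binary.PropositionalEquality using (_≡_)

record Graph (n : ℕ) : Set where
  field
    adj    : Fin n → Fin n → Bool
    sym    : ∀ x y → adj x y ≡ adj y x
    irrefl : ∀ x → adj x x ≡ false
open Graph public

VSet : ℕ → Set
VSet n = Fin n → Bool

∅ : ∀ {n} → VSet n
∅ _ = false

full : ∀ {n} → VSet n
full _ = true

insert : ∀ {n} → Fin n → VSet n → VSet n
insert x A y = if ⌊ y ≟ x ⌋ then true else A y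

minus2 : ∀ {n} → Fin n → Fin n → VSet n
minus2 u v y = not (⌊ y ≟ u ⌋ ∨ ⌊ y ≟ v ⌋)

module _ {n : ℕ} (G : Graph n) where

  InClosedNbhd : Fin n → Fin n → Set
  InClosedNbhd x y = (y ≡ x) ⊎ (adj G x y ≡ true)

  Leaf : Fin n → Set
  Leaf v = Σ (Fin n) λ w → (adj G v w ≡ true) × (∀ w' → adj G v w' ≡ true → w' ≡ w)

  WeakSupportOf : Fin n → Fin n → Set
  WeakSupportOf u v = Leaf v × (adj G u v ≡ true)
                      × (∀ w → adj G u w ≡ true → Leaf w → w ≡ v)

  -- The Maker-Breaker domination game is played on the induced subgraph
  -- G[W] (W a vertex set); for G itself W = full, for G - {u,v} W = minus2 u v.
  module Game (W : VSet n) where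

    Free : VSet n → VSet n → Fin n → Set
    Free D S x = (W x ≡ true) × (D x ≡ false) × (S x ≡ false)

    DomWon : VSet n → Set
    DomWon D = ∀ x → W x ≡ true →
               Σ (Fin n) λ y → (W y ≡ true) × (D y ≡ true) × InClosedNbhd x y

    StaWon : VSet n → Set
    StaWon S = Σ (Fin n) λ x → (W x ≡ true) ×
               (∀ y → W y ≡ true → InClosedNbhd x y → S y ≡ true)

    data Turn : Set where
      dominator staller : Turn

    -- SW k t D S : from the position where Dominator has played D, Staller
    -- has played S and player t is to move, Staller can force a win playing
    -- at most k further vertices, whatever Dominator does.
    data SW : ℕ → Turn → VSet n → VSet n → Set where
      done : ∀ {k t D S} → StaWon S → SW k t D S
      stal : ∀ {k D S} → ¬ DomWon D → (x : Fin n) → Free D S x →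
             SW k dominator D (insert x S) → SW (suc k) staller D S
      dom  : ∀ {k D S} → ¬ DomWon D →
             (∀ x → Free D S x → SW k staller (insert x D) S) →
             SW k dominator D S

    γSMB≤ : ℕ → Set
    γSMB≤ k = SW k dominator ∅ ∅

    γ'SMB≤ : ℕ → Set
    γ'SMB≤ k = SW k staller ∅ ∅

-- Only two facts about u and v are used: v is a leaf and u is its neighbour. Every closed neighbourhood of a vertex of G' = G − {u,v} meets {u,v} at most in
-- u, and N[u], N[v] ⊇ {u,v}. Hence, once each player owns one of u and v, a Staller win on G from
-- that position yields one on G', and conversely when Dominator's vertex is v. Staller turns a
-- G'-strategy into an S-game win on G by taking u first: if Dominator answers v she continues on
-- G', otherwise she takes v and wins at once. Conversely a Staller strategy on G is replayed on
-- G' while it avoids u and v; when it takes one of them, Dominator answers with the other and the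
-- rest is a game on G'. Throughout, Dominator can never have dominated G' while u is still free,
-- since taking u would dominate G.
module Submission where

open import Defs hiding (sym)
open import Data.Nat using (ℕ; zero; suc)
open import Data.Fin using (Fin; _≟_)
open import Data.Bool using (true; false)
open import Data.Product using (Σ; _×_; _,_)
open import Data.Sum using (_⊎_; inj₁; inj₂)
open import Data.Empty using (⊥-elim)
open import Relation.Nullary using (¬_; yes; no)
open import Relation.Binary.PropositionalEquality using (_≡_; _≢_; refl; sym; trans)

≡true⇒≢false : ∀ {b} → b ≡ true → b ≢ false
≡true⇒≢false refl ()

module _ {n : ℕ} where

  _≗[_]_ : VSet n → VSet n → VSet n → Set
  A ≗[ W ] B = ∀ y → W y ≡ true → A y ≡ B y

  Disjoint : VSet n → VSet n → Set
  Disjoint A B = ∀ y → A y ≡ true → B y ≡ false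

  insert-self : ∀ x (A : VSet n) → insert x A x ≡ true
  insert-self x A with x ≟ x
  ... | yes _   = refl
  ... | no x≢x = ⊥-elim (x≢x refl)

  insert-other : ∀ {x y} (A : VSet n) → y ≢ x → insert x A y ≡ A y
  insert-other {x} {y} A y≢x with y ≟ x
  ... | yes y≡x = ⊥-elim (y≢x y≡x)
  ... | no _    = refl

  insert-⊇ : ∀ {x y} (A : VSet n) → A y ≡ true → insert x A y ≡ true
  insert-⊇ {x} {y} A Ay with y ≟ x
  ... | yes _ = refl
  ... | no _  = Ay

  insert-false⇒≢ : ∀ {x y} (A : VSet n) → insert x A y ≡ false → y ≢ x
  insert-false⇒≢ {x} A h refl = ≡true⇒≢false (insert-self x A) h

  insert-cong : ∀ {x W} {A B : VSet n} → A ≗[ W ] B → insert x A ≗[ W ] insert x B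
  insert-cong {x} A≗B y Wy with y ≟ x
  ... | yes _ = refl
  ... | no _  = A≗B y Wy

  insert-outside : ∀ {x W} (A : VSet n) → W x ≡ false → insert x A ≗[ W ] A
  insert-outside A Wx y Wy = insert-other A λ { refl → ≡true⇒≢false Wy Wx }

  insert-disjointˡ : ∀ {x} {A B : VSet n} → B x ≡ false → Disjoint A B → Disjoint (insert x A) B
  insert-disjointˡ {x} Bx disj y Ay with y ≟ x
  ... | yes refl = Bx
  ... | no _     = disj y Ay

  insert-disjointʳ : ∀ {x} {A B : VSet n} → A x ≡ false → Disjoint A B → Disjoint A (insert x B)
  insert-disjointʳ {x} Ax disj y Ay with y ≟ x
  ... | yes refl = ⊥-elim (≡true⇒≢false Ay Ax)
  ... | no _     = disj y Ay

InClosedNbhd-sym : ∀ {n} (G : Graph n) {x y} → InClosedNbhd G x y → InClosedNbhd G y x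
InClosedNbhd-sym G (inj₁ refl) = inj₁ refl
InClosedNbhd-sym G {x} {y} (inj₂ xy) = inj₂ (trans (Graph.sym G y x) xy)

module _ {n : ℕ} (G : Graph n) (W : VSet n) where
  open Game G W

  SW-suc : ∀ {k t D S} → SW k t D S → SW (suc k) t D S
  SW-suc (done won)          = done won
  SW-suc (stal ¬won x free s) = stal ¬won x free (SW-suc s)
  SW-suc (dom ¬won f)         = dom ¬won λ x free → SW-suc (f x free)

  domWon⇒¬staWon : ∀ {D S} → DomWon D → Disjoint D S → ¬ StaWon S
  domWon⇒¬staWon domWon disj (x , Wx , N[x]⊆S) =
    let (y , Wy , Dy , xy) = domWon x Wx in ≡true⇒≢false (N[x]⊆S y Wy xy) (disj y Dy)

  ¬domWon∅ : ∀ {x} → W x ≡ true → ¬ DomWon ∅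
  ¬domWon∅ Wx domWon with domWon _ Wx
  ... | _ , _ , () , _

  ¬γ'SMB≤0 : ¬ γ'SMB≤ 0
  ¬γ'SMB≤0 (done (x , Wx , N[x]⊆∅)) with N[x]⊆∅ x Wx (inj₁ refl)
  ... | ()

module LeafRemoval {n : ℕ} (G : Graph n) {u v : Fin n}
                   (leaf : Leaf G v) (uv : adj G u v ≡ true) where

  W' : VSet n
  W' = minus2 u v

  module GF = Game G full
  module GW = Game G W'

  N : Fin n → Fin n → Set
  N = InClosedNbhd G

  u≢v : u ≢ v
  u≢v refl = ≡true⇒≢false uv (irrefl G u)

  Removed : Fin n → Set
  Removed y = y ≡ u ⊎ y ≡ v

  N[v]-removed : ∀ {y} → N v y → Removed y
  N[v]-removed (inj₁ y≡v) = inj₂ y≡v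
  N[v]-removed {y} (inj₂ vy) =
    let (_ , _ , unique) = leaf in inj₁ (trans (unique y vy) (sym (unique u (trans (Graph.sym G v u) uv))))

  removed-N : ∀ {z y} → Removed z → Removed y → N z y
  removed-N (inj₁ refl) (inj₁ refl) = inj₁ refl
  removed-N (inj₁ refl) (inj₂ refl) = inj₂ uv
  removed-N (inj₂ refl) (inj₁ refl) = inj₂ (trans (Graph.sym G v u) uv)
  removed-N (inj₂ refl) (inj₂ refl) = inj₁ refl

  removed⇒W'-false : ∀ {y} → Removed y → W' y ≡ false
  removed⇒W'-false {y} r with y ≟ u | y ≟ v
  ... | yes _ | _     = refl
  ... | no _  | yes _ = refl
  ... | no y≢u | no y≢v with r
  ...   | inj₁ y≡u = ⊥-elim (y≢u y≡u)
  ...   | inj₂ y≡v = ⊥-elim (y≢v y≡v)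

  W'-false⇒removed : ∀ {y} → W' y ≡ false → Removed y
  W'-false⇒removed {y} h with y ≟ u | y ≟ v
  ... | yes y≡u | _       = inj₁ y≡u
  ... | no _    | yes y≡v = inj₂ y≡v

  W'⇒¬removed : ∀ {y} → W' y ≡ true → ¬ Removed y
  W'⇒¬removed Wy r = ≡true⇒≢false Wy (removed⇒W'-false r)

  W'-intro : ∀ {y} → y ≢ u → y ≢ v → W' y ≡ true
  W'-intro {y} y≢u y≢v with W' y in eq
  ... | true  = refl
  ... | false with W'-false⇒removed eq
  ...   | inj₁ y≡u = ⊥-elim (y≢u y≡u)
  ...   | inj₂ y≡v = ⊥-elim (y≢v y≡v)

  v∉N[W'] : ∀ {x} → W' x ≡ true → ¬ N x v
  v∉N[W'] Wx xv = W'⇒¬removed Wx (N[v]-removed (InClosedNbhd-sym G xv))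

  insert-W'-removed : ∀ {x y} (A : VSet n) → W' x ≡ true → Removed y → insert x A y ≡ A y
  insert-W'-removed A Wx r = insert-other A λ { refl → W'⇒¬removed Wx r }

  removed-false : ∀ {y} {A : VSet n} → Removed y → A u ≡ false → A v ≡ false → A y ≡ false
  removed-false (inj₁ refl) Au _ = Au
  removed-false (inj₂ refl) _ Av = Av

  domWon-extend : ∀ {D⁺ D a} → D⁺ ≗[ W' ] D → Removed a → D⁺ a ≡ true →
                  GW.DomWon D → GF.DomWon D⁺
  domWon-extend D⁺≗D ra D⁺a domWon x _ with W' x in Wx
  ... | true  = let (y , Wy , Dy , xy) = domWon x Wx in y , refl , trans (D⁺≗D y Wy) Dy , xy
  ... | false = _ , refl , D⁺a , removed-N (W'-false⇒removed Wx) ra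

  domWon-restrict : ∀ {D⁺ D} → D⁺ ≗[ W' ] D → D⁺ u ≡ false → GF.DomWon D⁺ → GW.DomWon D
  domWon-restrict D⁺≗D D⁺u domWon x Wx =
    let (y , _ , D⁺y , xy) = domWon x refl
        Wy = W'-intro {y} (λ { refl → ≡true⇒≢false D⁺y D⁺u }) (λ { refl → v∉N[W'] Wx xy })
    in y , Wy , trans (sym (D⁺≗D y Wy)) D⁺y , xy

  staWon-restrict : ∀ {S⁺ S c} → S⁺ ≗[ W' ] S → Removed c → S⁺ c ≡ false →
                    GF.StaWon S⁺ → GW.StaWon S
  staWon-restrict S⁺≗S rc S⁺c (x , _ , N[x]⊆S⁺) with W' x in Wx
  ... | true  = x , Wx , λ y Wy xy → trans (sym (S⁺≗S y Wy)) (N[x]⊆S⁺ y refl xy)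
  ... | false = ⊥-elim (≡true⇒≢false (N[x]⊆S⁺ _ refl (removed-N (W'-false⇒removed Wx) rc)) S⁺c)

  staWon-extend : ∀ {S⁺ S} → S⁺ ≗[ W' ] S → S⁺ u ≡ true → GW.StaWon S → GF.StaWon S⁺
  staWon-extend {S⁺} S⁺≗S S⁺u (x , Wx , N[x]⊆S) = x , refl , N[x]⊆S⁺
    where
    N[x]⊆S⁺ : ∀ y → true ≡ true → N x y → S⁺ y ≡ true
    N[x]⊆S⁺ y _ xy with W' y in Wy
    ... | true  = trans (S⁺≗S y Wy) (N[x]⊆S y Wy xy)
    ... | false with W'-false⇒removed {y} Wy
    ...   | inj₁ refl = S⁺u
    ...   | inj₂ refl = ⊥-elim (v∉N[W'] Wx xy)

  restrictTurn : GF.Turn → GW.Turn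
  restrictTurn GF.dominator = GW.dominator
  restrictTurn GF.staller   = GW.staller

  extendTurn : GW.Turn → GF.Turn
  extendTurn GW.dominator = GF.dominator
  extendTurn GW.staller   = GF.staller

  -- In a position satisfying Split a b, Dominator owns a and Staller owns b.
  Split : Fin n → Fin n → Set
  Split a b = (a ≡ u × b ≡ v) ⊎ (a ≡ v × b ≡ u)

  split-removedˡ : ∀ {a b} → Split a b → Removed a
  split-removedˡ (inj₁ (a≡u , _)) = inj₁ a≡u
  split-removedˡ (inj₂ (a≡v , _)) = inj₂ a≡v

  split-removedʳ : ∀ {a b} → Split a b → Removed b
  split-removedʳ (inj₁ (_ , b≡v)) = inj₂ b≡v
  split-removedʳ (inj₂ (_ , b≡u)) = inj₁ b≡u

  split-≢ : ∀ {a b} → Split a b → a ≢ b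
  split-≢ (inj₁ (refl , refl)) = u≢v
  split-≢ (inj₂ (refl , refl)) a≡b = u≢v (sym a≡b)

  split-W' : ∀ {a b y} → Split a b → y ≢ a → y ≢ b → W' y ≡ true
  split-W' (inj₁ (refl , refl)) y≢a y≢b = W'-intro y≢a y≢b
  split-W' (inj₂ (refl , refl)) y≢a y≢b = W'-intro y≢b y≢a

  partner : ∀ {b} → Removed b → Σ (Fin n) λ a → Split a b
  partner (inj₁ refl) = v , inj₂ (refl , refl)
  partner (inj₂ refl) = u , inj₁ (refl , refl)

  split-restrict : ∀ {k t D⁺ S⁺ D S a b} → Split a b →
                   D⁺ ≗[ W' ] D → S⁺ ≗[ W' ] S → D⁺ a ≡ true → S⁺ a ≡ false → S⁺ b ≡ true →
                   GF.SW k t D⁺ S⁺ → GW.SW k (restrictTurn t) D S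
  split-restrict ab D⁺≗D S⁺≗S D⁺a S⁺a S⁺b (GF.done won) =
    GW.done (staWon-restrict S⁺≗S (split-removedˡ ab) S⁺a won)
  split-restrict {S⁺ = S⁺} ab D⁺≗D S⁺≗S D⁺a S⁺a S⁺b (GF.stal ¬won x (_ , D⁺x , S⁺x) s) =
    GW.stal (λ won → ¬won (domWon-extend D⁺≗D (split-removedˡ ab) D⁺a won))
            x (Wx , trans (sym (D⁺≗D x Wx)) D⁺x , trans (sym (S⁺≗S x Wx)) S⁺x)
            (split-restrict ab D⁺≗D (insert-cong S⁺≗S) D⁺a
                            (trans (insert-other S⁺ λ { refl → x≢a refl }) S⁺a) (insert-⊇ S⁺ S⁺b) s)
    where
    x≢a : x ≢ _
    x≢a refl = ≡true⇒≢false D⁺a D⁺x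
    Wx : W' x ≡ true
    Wx = split-W' ab x≢a λ { refl → ≡true⇒≢false S⁺b S⁺x }
  split-restrict {D⁺ = D⁺} ab D⁺≗D S⁺≗S D⁺a S⁺a S⁺b (GF.dom ¬won f) =
    GW.dom (λ won → ¬won (domWon-extend D⁺≗D (split-removedˡ ab) D⁺a won))
           λ { x (Wx , Dx , Sx) →
             split-restrict ab (insert-cong D⁺≗D) S⁺≗S (insert-⊇ D⁺ D⁺a) S⁺a S⁺b
                            (f x (refl , trans (D⁺≗D x Wx) Dx , trans (S⁺≗S x Wx) Sx)) }

  split-extend : ∀ {k t D S D⁺ S⁺} → D⁺ ≗[ W' ] D → S⁺ ≗[ W' ] S →
                 D⁺ v ≡ true → D⁺ u ≡ false → S⁺ u ≡ true →
                 GW.SW k t D S → GF.SW k (extendTurn t) D⁺ S⁺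
  split-extend D⁺≗D S⁺≗S D⁺v D⁺u S⁺u (GW.done won) = GF.done (staWon-extend S⁺≗S S⁺u won)
  split-extend {S⁺ = S⁺} D⁺≗D S⁺≗S D⁺v D⁺u S⁺u (GW.stal ¬won x (Wx , Dx , Sx) s) =
    GF.stal (λ won → ¬won (domWon-restrict D⁺≗D D⁺u won))
            x (refl , trans (D⁺≗D x Wx) Dx , trans (S⁺≗S x Wx) Sx)
            (split-extend D⁺≗D (insert-cong S⁺≗S) D⁺v D⁺u (insert-⊇ S⁺ S⁺u) s)
  split-extend {D⁺ = D⁺} D⁺≗D S⁺≗S D⁺v D⁺u S⁺u (GW.dom ¬won f) =
    GF.dom (λ won → ¬won (domWon-restrict D⁺≗D D⁺u won))
           λ { x (_ , D⁺x , S⁺x) →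
             let Wx = W'-intro {x} (λ { refl → ≡true⇒≢false S⁺u S⁺x })
                               (λ { refl → ≡true⇒≢false D⁺v D⁺x })
             in split-extend (insert-cong D⁺≗D) S⁺≗S (insert-⊇ D⁺ D⁺v)
                             (trans (insert-W'-removed D⁺ Wx (inj₁ refl)) D⁺u) S⁺u
                             (f x (Wx , trans (sym (D⁺≗D x Wx)) D⁺x , trans (sym (S⁺≗S x Wx)) S⁺x)) }

  staWon-impossible : ∀ {D S} → GW.DomWon D → Disjoint D S → S u ≡ false → ¬ GF.StaWon S
  staWon-impossible domWon disj Su won =
    domWon⇒¬staWon G W' domWon disj (staWon-restrict (λ _ _ → refl) (inj₁ refl) Su won)

  ¬SW-after-u : ∀ {k D S} → GW.DomWon D → Disjoint D S → S u ≡ false →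
                ¬ GF.SW k GF.staller (insert u D) S
  ¬SW-after-u domWon disj Su (GF.done won) = staWon-impossible domWon disj Su won
  ¬SW-after-u {D = D} domWon disj Su (GF.stal ¬won _ _ _) =
    ¬won (domWon-extend (insert-outside D (removed⇒W'-false (inj₁ refl))) (inj₁ refl)
                        (insert-self u D) domWon)

  ¬SW-before-u : ∀ {k D S} → GW.DomWon D → Disjoint D S → D u ≡ false → S u ≡ false →
                 ¬ GF.SW k GF.dominator D S
  ¬SW-before-u domWon disj Du Su (GF.done won) = staWon-impossible domWon disj Su won
  ¬SW-before-u domWon disj Du Su (GF.dom _ f)   = ¬SW-after-u domWon disj Su (f u (refl , Du , Su))

  answer-removed : ∀ {k D S a b} → Split a b → D a ≡ false → S a ≡ false →
                   GF.SW k GF.dominator D (insert b S) → GW.SW k GW.staller D S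
  answer-removed {S = S} ab Da Sa (GF.done won) =
    GW.done (staWon-restrict (insert-outside S (removed⇒W'-false (split-removedʳ ab)))
                             (split-removedˡ ab) (trans (insert-other S (split-≢ ab)) Sa) won)
  answer-removed {D = D} {S} {a} {b} ab Da Sa (GF.dom _ f) =
    split-restrict ab (insert-outside D (removed⇒W'-false (split-removedˡ ab)))
                      (insert-outside S (removed⇒W'-false (split-removedʳ ab)))
                      (insert-self a D) Sa' (insert-self b S) (f a (refl , Da , Sa'))
    where
    Sa' : insert b S a ≡ false
    Sa' = trans (insert-other S (split-≢ ab)) Sa

  restrict : ∀ {k t D S} → D u ≡ false → D v ≡ false → S u ≡ false → S v ≡ false → Disjoint D S →
             GF.SW k t D S → GW.SW k (restrictTurn t) D S
  restrict Du Dv Su Sv disj (GF.done won) =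
    GW.done (staWon-restrict (λ _ _ → refl) (inj₁ refl) Su won)
  restrict {S = S} Du Dv Su Sv disj (GF.stal _ x (_ , Dx , Sx) s) with W' x in Wx
  ... | true =
    GW.stal (λ won → ¬SW-before-u won disj' Du Su' s) x (Wx , Dx , Sx)
            (restrict Du Dv Su' (trans (insert-W'-removed S Wx (inj₂ refl)) Sv) disj' s)
    where
    Su' = trans (insert-W'-removed S Wx (inj₁ refl)) Su
    disj' = insert-disjointʳ Dx disj
  ... | false =
    -- Staller's move on u or v is not replayed on G', which saves her one move.
    let (a , ab) = partner (W'-false⇒removed Wx)
        ra = split-removedˡ ab
    in SW-suc G W' (answer-removed ab (removed-false ra Du Dv) (removed-false ra Su Sv) s)
  restrict {D = D} Du Dv Su Sv disj (GF.dom _ f) =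
    GW.dom (λ won → ¬SW-after-u won disj Su (f u (refl , Du , Su)))
           λ { x (Wx , Dx , Sx) →
             restrict (trans (insert-W'-removed D Wx (inj₁ refl)) Du)
                      (trans (insert-W'-removed D Wx (inj₂ refl)) Dv) Su Sv
                      (insert-disjointˡ Sx disj) (f x (refl , Dx , Sx)) }

  staller-takes-v : ∀ {k D S} → D u ≡ false → D v ≡ false → S u ≡ true → S v ≡ false →
                    GF.SW (suc k) GF.staller D S
  staller-takes-v {D = D} {S} Du Dv Su Sv =
    GF.stal ¬won v (refl , Dv , Sv) (GF.done (v , refl , λ y _ vy → N[v]⊆S y (N[v]-removed vy)))
    where
    ¬won : ¬ GF.DomWon D
    ¬won won = let (y , _ , Dy , vy) = won v refl
               in ≡true⇒≢false Dy (removed-false (N[v]-removed vy) Du Dv)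
    N[v]⊆S : ∀ y → Removed y → insert v S y ≡ true
    N[v]⊆S _ (inj₁ refl) = insert-⊇ S Su
    N[v]⊆S _ (inj₂ refl) = insert-self v S

  γ'SMB≤-extend : ∀ k → GW.γ'SMB≤ k → GF.γ'SMB≤ (suc k)
  γ'SMB≤-extend zero    h = ⊥-elim (¬γ'SMB≤0 G W' h)
  γ'SMB≤-extend (suc k) h =
    GF.stal (¬domWon∅ G full {u} refl) u (refl , refl , refl) (GF.dom (¬domWon∅ G full {u} refl) reply)
    where
    reply : ∀ x → GF.Free ∅ (insert u ∅) x → GF.SW (suc k) GF.staller (insert x ∅) (insert u ∅)
    reply x (_ , _ , Sx) with x ≟ v
    ... | yes refl =
      split-extend (insert-outside ∅ (removed⇒W'-false (inj₂ refl)))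
                   (insert-outside ∅ (removed⇒W'-false (inj₁ refl)))
                   (insert-self v ∅) (insert-other ∅ u≢v) (insert-self u ∅) h
    ... | no x≢v =
      staller-takes-v (insert-other ∅ λ { refl → insert-false⇒≢ ∅ Sx refl })
                      (insert-other ∅ λ { refl → x≢v refl })
                      (insert-self u ∅) (insert-other ∅ λ { refl → u≢v refl })

  γ'SMB≤-restrict : ∀ k → GF.γ'SMB≤ k → GW.γ'SMB≤ k
  γ'SMB≤-restrict k = restrict refl refl refl refl λ _ ()

  γSMB≤-restrict : ∀ k → GF.γSMB≤ k → GW.γSMB≤ k
  γSMB≤-restrict k = restrict refl refl refl refl λ _ ()

proposition4p1 : ∀ {n} (G : Graph n) (u v : Fin n) → WeakSupportOf G u v →
    ((k : ℕ) → Game.γ'SMB≤ G (minus2 u v) k → Game.γ'SMB≤ G full (suc k))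
    × ((k : ℕ) → Game.γ'SMB≤ G full k → Game.γ'SMB≤ G (minus2 u v) k)
    × ((k : ℕ) → Game.γSMB≤ G full k → Game.γSMB≤ G (minus2 u v) k)
proposition4p1 G u v (leaf , uv , _) =
  γ'SMB≤-extend , γ'SMB≤-restrict , γSMB≤-restrict
  where open LeafRemoval G leaf uv
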